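{- Let $n\in\mathbb{N}$ and $u\in\mathcal{A}_n^*$. Then $u$ is highest-weight (no $e_i$, $i\in\{1,\dots,n-1\}$, is defined on $u$) if and only if $u$ contains every symbol of $\{1,\dots,\max(u)\}$ and $u$ has an $i$-inversion for every $i\in\{1,\dots,\max(u)-1\}$.
   Context: $\mathcal{A}_n=\{1<\dots<n\}$; $\max(u)$ is the largest letter of $u$ (taken to be $0$ for the empty word). A word $u$ has an $i$-inversion if it contains a letter $i+1$ to the left of a letter $i$. Quasi-Kashiwara raising operator: if $u$ has an $i$-inversion, $e_i(u)$ is undefined; otherwise $e_i(u)$ is $u$ with its leftmost letter $i+1$ replaced by $i$, undefined if $u$ has no letter $i+1$. -}

module Defs where

open import Data.Nat using (ℕ; zero; suc; _≤_; _<_; _⊔_; _≡ᵇ_; _∸_)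
open import Data.Bool using (Bool; true; false; if_then_else_; _∨_)
open import Data.List using (List; []; _∷_; _++_)
open import Data.List.Relation.Unary.All using (All)
open import Data.List.Membership.Propositional using (_∈_)
open import Data.Maybe using (Maybe; just; nothing; map; Is-just)
open import Data.Product using (_×_; ∃-syntax; _,_)
open import Relation.Binary.PropositionalEquality using (_≡_)

Word : Set
Word = List ℕ

IsWordOver : ℕ → Word → Set
IsWordOver n u = All (λ a → 1 ≤ a × a ≤ n) u

maxLetter : Word → ℕ
maxLetter [] = 0
maxLetter (a ∷ u) = a ⊔ maxLetter u

HasInversion : ℕ → Word → Set
HasInversion i u = ∃[ xs ] ∃[ ys ] (u ≡ xs ++ (suc i ∷ ys) × i ∈ ys)

containsᵇ : ℕ → Word → Bool
containsᵇ a [] = false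
containsᵇ a (b ∷ u) = (a ≡ᵇ b) ∨ containsᵇ a u

hasInversionᵇ : ℕ → Word → Bool
hasInversionᵇ i [] = false
hasInversionᵇ i (b ∷ u) =
  (if b ≡ᵇ suc i then containsᵇ i u else false) ∨ hasInversionᵇ i u

replaceLeftmost : ℕ → Word → Maybe Word
replaceLeftmost i [] = nothing
replaceLeftmost i (b ∷ u) =
  if b ≡ᵇ suc i then just (i ∷ u) else map (b ∷_) (replaceLeftmost i u)

e : ℕ → Word → Maybe Word
e i u = if hasInversionᵇ i u then nothing else replaceLeftmost i u

HighestWeight : ℕ → Word → Set
HighestWeight n u = ∀ i → 1 ≤ i → i ≤ n ∸ 1 → e i u ≡ nothing

-- A letter i+1 of u can only be left unraised by e_i if an i occurs to its
-- right, so a highest-weight word is closed downwards from its maximal letter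
-- and has every i-inversion below it. Conversely, for i < max(u) the assumed
-- i-inversion blocks e_i, and for i ≥ max(u) there is no letter i+1 to raise.
module Submission where

open import Defs
open import Data.Nat using (ℕ; zero; suc; _≤_; _<_; _∸_; _⊔_; _≡ᵇ_; z≤n; s≤s; _≤?_)
open import Data.Nat.Properties
open import Data.Bool using (true; false)
open import Data.Bool.Properties using (∨-zeroʳ; T-≡)
open import Data.Sum using (inj₁; inj₂)
open import Data.Maybe using (just; nothing)
open import Data.List using ([]; _∷_; _++_)
open import Data.List.Relation.Unary.All using ([]; _∷_)
open import Data.List.Relation.Unary.Any using (here; there)
open import Data.Product using (_×_; _,_)
open import Data.List.Membership.Propositional using (_∈_; _∉_)
open import Data.List.Membership.Propositional.Properties using (∈-++⁺ʳ)
open import Function.Base using (_∘_)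
open import Function.Bundles using (_⇔_; mk⇔; Equivalence)
open import Relation.Nullary using (yes; no; contradiction)
open import Relation.Binary.PropositionalEquality

private
  variable
    a i m n : ℕ
    u : Word

≡ᵇ≡true⇒≡ : (m ≡ᵇ n) ≡ true → m ≡ n
≡ᵇ≡true⇒≡ {m} {n} p = ≡ᵇ⇒≡ m n (Equivalence.from T-≡ p)

≡ᵇ-refl : ∀ n → (n ≡ᵇ n) ≡ true
≡ᵇ-refl n = Equivalence.to T-≡ (≡⇒≡ᵇ n n refl)

<⇒≤∸1 : m < n → m ≤ n ∸ 1
<⇒≤∸1 (s≤s m≤n) = m≤n

≤∸1⇒< : 1 ≤ m → m ≤ n ∸ 1 → m < n
≤∸1⇒< {n = zero}  (s≤s _) ()
≤∸1⇒< {n = suc n} _       m≤n = s≤s m≤n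

containsᵇ⇒∈ : containsᵇ a u ≡ true → a ∈ u
containsᵇ⇒∈ {a} {b ∷ u} p with a ≡ᵇ b in a≡ᵇb
... | true  = here (≡ᵇ≡true⇒≡ a≡ᵇb)
... | false = there (containsᵇ⇒∈ p)

∈⇒containsᵇ : a ∈ u → containsᵇ a u ≡ true
∈⇒containsᵇ {a} (here refl) rewrite ≡ᵇ-refl a = refl
∈⇒containsᵇ (there a∈u) rewrite ∈⇒containsᵇ a∈u = ∨-zeroʳ _

HasInversion-∷ : ∀ b → HasInversion i u → HasInversion i (b ∷ u)
HasInversion-∷ b (xs , ys , refl , i∈ys) = b ∷ xs , ys , refl , i∈ys

hasInversionᵇ⇒HasInversion : hasInversionᵇ i u ≡ true → HasInversion i u
hasInversionᵇ⇒HasInversion {i} {b ∷ u} p with b ≡ᵇ suc i in b≡ᵇ1+i | containsᵇ i u in i∈ᵇu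
... | true  | true  = [] , u , cong (_∷ u) (≡ᵇ≡true⇒≡ b≡ᵇ1+i) , containsᵇ⇒∈ i∈ᵇu
... | true  | false = HasInversion-∷ b (hasInversionᵇ⇒HasInversion p)
... | false | _     = HasInversion-∷ b (hasInversionᵇ⇒HasInversion p)

HasInversion⇒hasInversionᵇ : HasInversion i u → hasInversionᵇ i u ≡ true
HasInversion⇒hasInversionᵇ {i} ([] , ys , refl , i∈ys)
  rewrite ≡ᵇ-refl i | ∈⇒containsᵇ i∈ys = refl
HasInversion⇒hasInversionᵇ (x ∷ xs , ys , refl , i∈ys)
  rewrite HasInversion⇒hasInversionᵇ (xs , ys , refl , i∈ys) = ∨-zeroʳ _

HasInversion⇒∈ : HasInversion i u → i ∈ u
HasInversion⇒∈ (xs , ys , refl , i∈ys) = ∈-++⁺ʳ xs (there i∈ys)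

∈⇒replaceLeftmost≢nothing : suc i ∈ u → replaceLeftmost i u ≢ nothing
∈⇒replaceLeftmost≢nothing {i} {b ∷ u} 1+i∈u with b ≡ᵇ suc i in b≡ᵇ1+i
∈⇒replaceLeftmost≢nothing {i} {b ∷ u} 1+i∈u         | true  = λ ()
∈⇒replaceLeftmost≢nothing {i} {b ∷ u} (here refl)   | false with () ← trans (sym b≡ᵇ1+i) (≡ᵇ-refl b)
∈⇒replaceLeftmost≢nothing {i} {b ∷ u} (there 1+i∈u) | false with replaceLeftmost i u in r
... | nothing = contradiction r (∈⇒replaceLeftmost≢nothing 1+i∈u)
... | just _  = λ ()

∉⇒replaceLeftmost≡nothing : suc i ∉ u → replaceLeftmost i u ≡ nothing
∉⇒replaceLeftmost≡nothing {u = []} _ = refl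
∉⇒replaceLeftmost≡nothing {i} {b ∷ u} 1+i∉u with b ≡ᵇ suc i in b≡ᵇ1+i
... | true  = contradiction (here (sym (≡ᵇ≡true⇒≡ b≡ᵇ1+i))) 1+i∉u
... | false rewrite ∉⇒replaceLeftmost≡nothing (1+i∉u ∘ there) = refl

HasInversion⇒e≡nothing : HasInversion i u → e i u ≡ nothing
HasInversion⇒e≡nothing inv rewrite HasInversion⇒hasInversionᵇ inv = refl

∉⇒e≡nothing : suc i ∉ u → e i u ≡ nothing
∉⇒e≡nothing {i} {u} 1+i∉u with hasInversionᵇ i u
... | true  = refl
... | false = ∉⇒replaceLeftmost≡nothing 1+i∉u

e≡nothing⇒HasInversion : suc i ∈ u → e i u ≡ nothing → HasInversion i u
e≡nothing⇒HasInversion {i} {u} 1+i∈u eᵢu≡nothing with hasInversionᵇ i u in inv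
... | true  = hasInversionᵇ⇒HasInversion inv
... | false = contradiction eᵢu≡nothing (∈⇒replaceLeftmost≢nothing 1+i∈u)

∈⇒≤maxLetter : a ∈ u → a ≤ maxLetter u
∈⇒≤maxLetter {u = b ∷ u} (here refl)  = m≤m⊔n b (maxLetter u)
∈⇒≤maxLetter {u = b ∷ u} (there a∈u) = ≤-trans (∈⇒≤maxLetter a∈u) (m≤n⊔m b (maxLetter u))

maxLetter∈ : 1 ≤ maxLetter u → maxLetter u ∈ u
maxLetter∈ {b ∷ u} 1≤max with ⊔-sel b (maxLetter u)
... | inj₁ max≡b = subst (_∈ b ∷ u) (sym max≡b) (here refl)
... | inj₂ max≡maxu = subst (_∈ b ∷ u) (sym max≡maxu)
                        (there (maxLetter∈ (subst (1 ≤_) max≡maxu 1≤max)))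

maxLetter≤ : IsWordOver n u → maxLetter u ≤ n
maxLetter≤ []                  = z≤n
maxLetter≤ ((_ , b≤n) ∷ u-over) = ⊔-lub b≤n (maxLetter≤ u-over)

downward-induction : ∀ (P : ℕ → Set) l m →
  (∀ a → l ≤ a → a < m → P (suc a) → P a) → P m → ∀ a → l ≤ a → a ≤ m → P a
downward-induction P l m step Pm a l≤a a≤m with m≤n⇒m<n∨m≡n a≤m
... | inj₂ refl = Pm
downward-induction P l (suc m) step P1+m a l≤a _ | inj₁ (s≤s a≤m) =
  downward-induction P l m (λ b l≤b b<m → step b l≤b (m<n⇒m<1+n b<m))
    (step m (≤-trans l≤a a≤m) ≤-refl P1+m) a l≤a a≤m

highestWeight⇒∈ : IsWordOver n u → HighestWeight n u →
  ∀ a → 1 ≤ a → a ≤ maxLetter u → a ∈ u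
highestWeight⇒∈ {u = u} u-over hw a 1≤a a≤max =
  downward-induction (_∈ u) 1 (maxLetter u) lower (maxLetter∈ (≤-trans 1≤a a≤max)) a 1≤a a≤max
  where
  lower : ∀ b → 1 ≤ b → b < maxLetter u → suc b ∈ u → b ∈ u
  lower b 1≤b b<max 1+b∈u = HasInversion⇒∈ (e≡nothing⇒HasInversion 1+b∈u
    (hw b 1≤b (<⇒≤∸1 (<-≤-trans b<max (maxLetter≤ u-over)))))

highestWeight⇒HasInversion : IsWordOver n u → HighestWeight n u →
  ∀ i → 1 ≤ i → i ≤ maxLetter u ∸ 1 → HasInversion i u
highestWeight⇒HasInversion u-over hw i 1≤i i≤max∸1 = e≡nothing⇒HasInversion
  (highestWeight⇒∈ u-over hw (suc i) (s≤s z≤n) (≤∸1⇒< 1≤i i≤max∸1))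
  (hw i 1≤i (≤-trans i≤max∸1 (∸-monoˡ-≤ 1 (maxLetter≤ u-over))))

∀HasInversion⇒e≡nothing : (∀ i → 1 ≤ i → i ≤ maxLetter u ∸ 1 → HasInversion i u) →
  ∀ i → 1 ≤ i → e i u ≡ nothing
∀HasInversion⇒e≡nothing {u} inversions i 1≤i with suc i ≤? maxLetter u
... | yes i<max = HasInversion⇒e≡nothing (inversions i 1≤i (<⇒≤∸1 i<max))
... | no  i≮max = ∉⇒e≡nothing {u = u} (i≮max ∘ ∈⇒≤maxLetter)

proposition6p14 : (n : ℕ) (u : Word) → IsWordOver n u →
    HighestWeight n u ⇔
      ((∀ a → 1 ≤ a → a ≤ maxLetter u → a ∈ u) ×
       (∀ i → 1 ≤ i → i ≤ maxLetter u ∸ 1 → HasInversion i u))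
proposition6p14 n u u-over = mk⇔
  (λ hw → highestWeight⇒∈ u-over hw , highestWeight⇒HasInversion u-over hw)
  (λ (_ , inversions) i 1≤i _ → ∀HasInversion⇒e≡nothing inversions i 1≤i)
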